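{- Let $F$ be a finite field and $q=|F|$. Let $k,m,n\in\mathbb{N}$ satisfy $k\leq m$ and $k\leq n+1$. Fix any $k$-tuple $a\in F^k$. Then \[\sum_{\substack{x\in F^{m+n+1};\\ x_{[0,k)}=a}}\ \sum_{\substack{v\in F^{1\times(m+1)};\\ v\neq 0}}[\,v\,H_{m,n}(x)=0\,]-q\sum_{\substack{x\in F^{m+n+1};\\ x_{[0,k)}=a}}\ \sum_{\substack{v\in F^{1\times m};\\ v\neq 0}}[\,v\,H_{m-1,n+1}(x)=0\,]=(q-1)q^{2m-k}.\]
   Context: $\mathbb{N}=\{0,1,2,\ldots\}$. For $x=(x_0,\ldots,x_{m+n})\in F^{m+n+1}$ and integers $p,t\geq -1$ with $p+t\leq m+n$, $H_{p,t}(x)$ is the $(p+1)\times(t+1)$ matrix $(x_{i+j})_{0\leq i\leq p,\ 0\leq j\leq t}$. For a tuple $x$, $x_{[0,k)}=(x_0,\ldots,x_{k-1})$. For a statement $\mathcal{A}$, $[\mathcal{A}]$ is $1$ if $\mathcal{A}$ is true and $0$ otherwise. -}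

module Defs where

open import Level using (Level; _⊔_)
open import Algebra.Bundles using (CommutativeRing)
open import Data.Nat using (ℕ; zero; suc)
open import Data.Fin using (Fin; toℕ)
open import Data.Fin.Properties using (all?)
open import Data.Vec using (Vec; []; _∷_; lookup)
open import Data.List using (List; []; _∷_; map; concatMap)
open import Data.Nat.ListAction using (sum)
open import Data.List.Relation.Unary.Any using (Any)
open import Data.List.Relation.Unary.AllPairs using (AllPairs)
open import Data.Product using (∃)
open import Data.Bool using (if_then_else_)
open import Relation.Nullary using (¬_; Dec; ¬?)
open import Relation.Nullary.Decidable using (⌊_⌋)
open import Relation.Binary using (Decidable)

record FiniteField (c ℓ : Level) : Set (Level.suc (c ⊔ ℓ)) where
  field
    commRing   : CommutativeRing c ℓ
  open CommutativeRing commRing public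
  field
    nontrivial : ¬ (1# ≈ 0#)
    inverse    : ∀ x → ¬ (x ≈ 0#) → ∃ λ y → x * y ≈ 1#
    _≟_        : Decidable _≈_
    elems      : List Carrier
    complete   : ∀ x → Any (x ≈_) elems
    unique     : AllPairs (λ a b → ¬ (a ≈ b)) elems

module _ {c ℓ : Level} (F : FiniteField c ℓ) where
  open FiniteField F

  card : ℕ
  card = Data.List.length elems

  tuples : (N : ℕ) → List (Vec Carrier N)
  tuples zero    = [] ∷ []
  tuples (suc N) = concatMap (λ a → map (a ∷_) (tuples N)) elems

  sumOver : (N : ℕ) → (Vec Carrier N → ℕ) → ℕ
  sumOver N f = sum (map f (tuples N))

  iv : ∀ {p} {P : Set p} → Dec P → ℕ
  iv d = if ⌊ d ⌋ then 1 else 0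

  -- x_i (0-indexed); the default 0# is never reached in the uses below
  at : ∀ {N} → Vec Carrier N → ℕ → Carrier
  at []      _       = 0#
  at (a ∷ _) zero    = a
  at (_ ∷ x) (suc i) = at x i

  Σfin : (P : ℕ) → (Fin P → Carrier) → Carrier
  Σfin zero    f = 0#
  Σfin (suc P) f = f Fin.zero + Σfin P (λ i → f (Fin.suc i))

  IsZero : ∀ {P} → Vec Carrier P → Set ℓ
  IsZero {P} v = ∀ (i : Fin P) → lookup v i ≈ 0#

  isZero? : ∀ {P} (v : Vec Carrier P) → Dec (IsZero v)
  isZero? v = all? (λ i → lookup v i ≟ 0#)

  -- v H_{P-1,T-1}(x) = 0, for v ∈ F^{1×P}: the j-th entry of the row
  -- vector v·H is Σ_{i<P} v_i x_{i+j}, for each column j < T.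
  HankelKills : ∀ {N} (P T : ℕ) → Vec Carrier P → Vec Carrier N → Set ℓ
  HankelKills P T v x =
    ∀ (j : Fin T) → Σfin P (λ i → lookup v i * at x (toℕ i Data.Nat.+ toℕ j)) ≈ 0#

  hankelKills? : ∀ {N} (P T : ℕ) (v : Vec Carrier P) (x : Vec Carrier N) →
                 Dec (HankelKills P T v x)
  hankelKills? P T v x = all? (λ j → Σfin P (λ i → lookup v i * at x (toℕ i Data.Nat.+ toℕ j)) ≟ 0#)

  PrefixIs : ∀ {N k} → Vec Carrier N → Vec Carrier k → Set ℓ
  PrefixIs {k = k} x a = ∀ (i : Fin k) → at x (toℕ i) ≈ lookup a i

  prefixIs? : ∀ {N k} (x : Vec Carrier N) (a : Vec Carrier k) → Dec (PrefixIs x a)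
  prefixIs? x a = all? (λ i → at x (toℕ i) ≟ lookup a i)

  countS : ∀ {k} (N P T : ℕ) → Vec Carrier k → ℕ
  countS N P T a =
    sumOver N (λ x → iv (prefixIs? x a) Data.Nat.*
      sumOver P (λ v → iv (¬? (isZero? v)) Data.Nat.* iv (hankelKills? P T v x)))

{-# OPTIONS --safe #-}
module Submission where

-- Write G_T(v) for the number of x with prefix a and v H_{·,T-1}(x) = 0, and let d be the
-- last index with v_d ≠ 0.  The T-th column condition Σ_i v_i x_{i+T} = 0 involves
-- x_{d+T} with the invertible coefficient v_d, while the prefix and the earlier columns
-- do not involve x_{d+T} at all; so as long as k ≤ d + T < m + n + 1 it cuts the count by
-- exactly q:  G_T(v) = q G_{T+1}(v).  For v ∈ F^{m+1} with v_m ≠ 0, iterating from T = 0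
-- (where G_0 = q^{m+n+1-k}) gives G_{n+1}(v) = q^{m-k}.  Splitting v ∈ F^{m+1} as (u, v_m),
-- the vectors with v_m = 0 contribute Σ_{u ≠ 0} G_{n+1}(u), which by a single step equals
-- q Σ_{u ≠ 0} G_{n+2}(u), the subtracted term; those with v_m ≠ 0 contribute
-- (q - 1) q^m q^{m-k}.

open import Defs
open import Level using (Level)
open import Data.Nat using (ℕ; zero; suc; _≤_; _<_; _+_; _*_; _∸_; _^_; s≤s; NonZero)
import Data.Nat.Properties as ℕP
open import Data.Fin using (Fin; toℕ; fromℕ; fromℕ<; inject₁; lower₁)
import Data.Fin.Properties as FinP
open import Data.Vec using (Vec; []; _∷_; lookup; _∷ʳ_; _[_]≔_)
open import Data.List using (List; []; _∷_; _++_; map; concatMap; length)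
import Data.List.Properties as ListP
open import Data.Nat.ListAction using (sum)
open import Data.Nat.ListAction.Properties using (sum-++)
open import Data.List.Relation.Unary.Any using (Any; here; there)
open import Data.List.Relation.Unary.All using (All; _∷_)
open import Data.List.Relation.Unary.AllPairs using (AllPairs; _∷_)
open import Data.Integer using (+_; _-_; _⊖_)
import Data.Integer.Properties as ℤP
open import Data.Product using (Σ; _×_; _,_; proj₁; proj₂)
open import Data.Empty using (⊥-elim)
open import Function using (_∘_; id)
open import Relation.Nullary using (¬_; Dec; yes; no; ¬?)
open import Relation.Unary using (Decidable)
open import Relation.Binary.PropositionalEquality
  using (_≡_; _≢_; _≗_; refl; sym; trans; cong; cong₂; subst; module ≡-Reasoning)
import Relation.Binary.Reasoning.Setoid as SetoidReasoning
open import Algebra.Properties.CommutativeSemigroup ℕP.+-commutativeSemigroup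
  using (interchange)
open import Algebra.Properties.CommutativeSemigroup ℕP.*-commutativeSemigroup
  using (x∙yz≈y∙xz)

private variable
  a b : Level
  A : Set a
  B : Set b

sum-map-cong : ∀ {f g : A → ℕ} → f ≗ g → ∀ xs → sum (map f xs) ≡ sum (map g xs)
sum-map-cong f≗g xs = cong sum (ListP.map-cong f≗g xs)

sum-map-+ : ∀ (f g : A → ℕ) xs →
            sum (map (λ x → f x + g x) xs) ≡ sum (map f xs) + sum (map g xs)
sum-map-+ f g []       = refl
sum-map-+ f g (x ∷ xs) =
  trans (cong (_+_ (f x + g x)) (sum-map-+ f g xs)) (interchange (f x) (g x) _ _)

sum-map-*ˡ : ∀ c (f : A → ℕ) xs → sum (map (λ x → c * f x) xs) ≡ c * sum (map f xs)
sum-map-*ˡ c f []       = sym (ℕP.*-zeroʳ c)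
sum-map-*ˡ c f (x ∷ xs) =
  trans (cong (_+_ (c * f x)) (sum-map-*ˡ c f xs)) (sym (ℕP.*-distribˡ-+ c (f x) _))

sum-map-*ʳ : ∀ (f : A → ℕ) c xs → sum (map (λ x → f x * c) xs) ≡ sum (map f xs) * c
sum-map-*ʳ f c xs = begin
  sum (map (λ x → f x * c) xs)  ≡⟨ sum-map-cong (λ x → ℕP.*-comm (f x) c) xs ⟩
  sum (map (λ x → c * f x) xs)  ≡⟨ sum-map-*ˡ c f xs ⟩
  c * sum (map f xs)            ≡⟨ ℕP.*-comm c _ ⟩
  sum (map f xs) * c            ∎
  where open ≡-Reasoning

sum-map-const : ∀ c (xs : List A) → sum (map (λ _ → c) xs) ≡ length xs * c
sum-map-const c []       = refl
sum-map-const c (x ∷ xs) = cong (_+_ c) (sum-map-const c xs)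

sum-map-concatMap : ∀ (f : B → ℕ) (g : A → List B) xs →
  sum (map f (concatMap g xs)) ≡ sum (map (λ x → sum (map f (g x))) xs)
sum-map-concatMap f g []       = refl
sum-map-concatMap f g (x ∷ xs) = begin
  sum (map f (g x ++ concatMap g xs))
    ≡⟨ cong sum (ListP.map-++ f (g x) (concatMap g xs)) ⟩
  sum (map f (g x) ++ map f (concatMap g xs))
    ≡⟨ sum-++ (map f (g x)) _ ⟩
  sum (map f (g x)) + sum (map f (concatMap g xs))
    ≡⟨ cong (_+_ (sum (map f (g x)))) (sum-map-concatMap f g xs) ⟩
  sum (map f (g x)) + sum (map (λ x → sum (map f (g x))) xs) ∎
  where open ≡-Reasoning

sum-map-comm : ∀ (f : A → B → ℕ) xs ys →
  sum (map (λ x → sum (map (f x) ys)) xs) ≡ sum (map (λ y → sum (map (λ x → f x y) xs)) ys)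
sum-map-comm f []       ys = sym (trans (sum-map-const 0 ys) (ℕP.*-zeroʳ (length ys)))
sum-map-comm f (x ∷ xs) ys =
  trans (cong (_+_ (sum (map (f x) ys))) (sum-map-comm f xs ys))
        (sym (sum-map-+ (f x) (λ y → sum (map (λ x → f x y) xs)) ys))

[+m+n]-[+m]≡+n : ∀ m n → + (m + n) - + m ≡ + n
[+m+n]-[+m]≡+n m n = begin
  + (m + n) - + m    ≡⟨ ℤP.[+m]-[+n]≡m⊖n (m + n) m ⟩
  (m + n) ⊖ m        ≡⟨ ℤP.⊖-≥ (ℕP.m≤m+n m n) ⟩
  + (m + n ∸ m)      ≡⟨ cong +_ (ℕP.m+n∸m≡n m n) ⟩
  + n                ∎
  where open ≡-Reasoning

x^m*[y*x^[m∸k]]≡y*x^[2m∸k] : ∀ x y m k → k ≤ m → x ^ m * (y * x ^ (m ∸ k)) ≡ y * x ^ (2 * m ∸ k)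
x^m*[y*x^[m∸k]]≡y*x^[2m∸k] x y m k k≤m = begin
  x ^ m * (y * x ^ (m ∸ k))  ≡⟨ x∙yz≈y∙xz (x ^ m) y _ ⟩
  y * (x ^ m * x ^ (m ∸ k))  ≡⟨ cong (y *_) (sym (ℕP.^-distribˡ-+-* x m (m ∸ k))) ⟩
  y * x ^ (m + (m ∸ k))      ≡⟨ cong (λ e → y * x ^ e) (sym (ℕP.+-∸-assoc m k≤m)) ⟩
  y * x ^ (m + m ∸ k)        ≡⟨ cong (λ e → y * x ^ (e ∸ k)) (cong (_+_ m) (sym (ℕP.+-identityʳ m))) ⟩
  y * x ^ (2 * m ∸ k)        ∎
  where open ≡-Reasoning

module _ {c ℓ : Level} (F : FiniteField c ℓ) where

  open FiniteField F
    using (Carrier; _≈_; 0#; 1#; _≟_; elems; complete; unique; inverse)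
    renaming (_+_ to _⊕_; _*_ to _⊛_; -_ to ⊝_)
  module R = FiniteField F

  q : ℕ
  q = card F

  Σᶠ : (Carrier → ℕ) → ℕ
  Σᶠ f = sum (map f elems)

  iv-cong : ∀ {ℓ₁ ℓ₂} {P : Set ℓ₁} {Q : Set ℓ₂} (P? : Dec P) (Q? : Dec Q) →
            (P → Q) → (Q → P) → iv F P? ≡ iv F Q?
  iv-cong (yes _) (yes _) _   _   = refl
  iv-cong (yes p) (no ¬q) P→Q _   = ⊥-elim (¬q (P→Q p))
  iv-cong (no ¬p) (yes q′) _  Q→P = ⊥-elim (¬p (Q→P q′))
  iv-cong (no _)  (no _)  _   _   = refl

  iv-yes : ∀ {ℓ₁} {P : Set ℓ₁} (P? : Dec P) → P → iv F P? ≡ 1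
  iv-yes (yes _) _ = refl
  iv-yes (no ¬p) p = ⊥-elim (¬p p)

  iv-× : ∀ {ℓ₁ ℓ₂ ℓ₃} {P : Set ℓ₁} {Q : Set ℓ₂} {S : Set ℓ₃} (S? : Dec S) (P? : Dec P) (Q? : Dec Q) →
         (S → P × Q) → (P → Q → S) → iv F S? ≡ iv F P? * iv F Q?
  iv-× (yes s) (yes _) (yes _) _   _    = refl
  iv-× (yes s) (no ¬p) _       S→PQ _   = ⊥-elim (¬p (proj₁ (S→PQ s)))
  iv-× (yes s) (yes _) (no ¬q) S→PQ _   = ⊥-elim (¬q (proj₂ (S→PQ s)))
  iv-× (no ¬s) (yes p) (yes q′) _  PQ→S = ⊥-elim (¬s (PQ→S p q′))
  iv-× (no _)  (yes _) (no _)  _   _    = refl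
  iv-× (no _)  (no _)  _       _   _    = refl

  Σᶠ-unique : ∀ {ℓ₁} {P : Carrier → Set ℓ₁} (P? : Decidable P) →
              (∀ {x y} → x ≈ y → P x → P y) → ∀ {c₀} → P c₀ → (∀ c → P c → c ≈ c₀) →
              Σᶠ (λ c → iv F (P? c)) ≡ 1
  Σᶠ-unique {P = P} P? resp {c₀} Pc₀ unique-c₀ = count-one elems unique (complete c₀)
    where
      count : List Carrier → ℕ
      count cs = sum (map (λ c → iv F (P? c)) cs)

      count-zero : ∀ cs → ¬ Any (c₀ ≈_) cs → count cs ≡ 0
      count-zero []       _     = refl
      count-zero (c ∷ cs) c₀∉cs with P? c
      ... | yes Pc = ⊥-elim (c₀∉cs (here (R.sym (unique-c₀ c Pc))))
      ... | no _   = count-zero cs (c₀∉cs ∘ there)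

      distinct-∉ : ∀ {c} cs → All (λ c′ → ¬ c ≈ c′) cs → c ≈ c₀ → ¬ Any (c₀ ≈_) cs
      distinct-∉ (_ ∷ _)  (c≉c′ ∷ _)   c≈c₀ (here c₀≈c′) = c≉c′ (R.trans c≈c₀ c₀≈c′)
      distinct-∉ (_ ∷ cs) (_ ∷ apart) c≈c₀ (there c₀∈cs) = distinct-∉ cs apart c≈c₀ c₀∈cs

      count-one : ∀ cs → AllPairs (λ c c′ → ¬ c ≈ c′) cs → Any (c₀ ≈_) cs → count cs ≡ 1
      count-one (c ∷ cs) (apart ∷ _) _ with P? c
      ... | yes Pc = cong suc (count-zero cs (distinct-∉ cs apart (unique-c₀ c Pc)))
      count-one (c ∷ cs) (_ ∷ _)      (here c₀≈c)    | no ¬Pc = ⊥-elim (¬Pc (resp c₀≈c Pc₀))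
      count-one (c ∷ cs) (_ ∷ pairs)  (there c₀∈cs) | no _   = count-one cs pairs c₀∈cs

  Σᶠ-≈ : ∀ c₀ → Σᶠ (λ c → iv F (c ≟ c₀)) ≡ 1
  Σᶠ-≈ c₀ = Σᶠ-unique (_≟ c₀) (λ x≈y x≈c₀ → R.trans (R.sym x≈y) x≈c₀) R.refl (λ _ c≈c₀ → c≈c₀)

  Σᶠ-≉0 : Σᶠ (λ c → iv F (¬? (c ≟ 0#))) ≡ q ∸ 1
  Σᶠ-≉0 = begin
    Σᶠ ≉0                        ≡⟨ sym (ℕP.m+n∸m≡n 1 _) ⟩
    1 + Σᶠ ≉0 ∸ 1                ≡⟨ cong (λ z → z + Σᶠ ≉0 ∸ 1) (sym (Σᶠ-≈ 0#)) ⟩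
    Σᶠ ≈0 + Σᶠ ≉0 ∸ 1            ≡⟨ cong (_∸ 1) (sym (sum-map-+ ≈0 ≉0 elems)) ⟩
    Σᶠ (λ c → ≈0 c + ≉0 c) ∸ 1   ≡⟨ cong (_∸ 1) (sum-map-cong ≈0+≉0 elems) ⟩
    Σᶠ (λ _ → 1) ∸ 1             ≡⟨ cong (_∸ 1) (trans (sum-map-const 1 elems) (ℕP.*-identityʳ q)) ⟩
    q ∸ 1                        ∎
    where
      open ≡-Reasoning
      ≈0 ≉0 : Carrier → ℕ
      ≈0 c = iv F (c ≟ 0#)
      ≉0 c = iv F (¬? (c ≟ 0#))
      ≈0+≉0 : ∀ c → ≈0 c + ≉0 c ≡ 1
      ≈0+≉0 c with c ≟ 0#
      ... | yes _ = refl
      ... | no _  = refl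

  q-nonZero : NonZero q
  -- 0# ∈ elems rules out the empty enumeration.
  q-nonZero with elems | complete 0#
  ... | _ ∷ _ | _ = _

  x≈0⇒x*y≈0 : ∀ {x} y → x ≈ 0# → x ⊛ y ≈ 0#
  x≈0⇒x*y≈0 y x≈0 = R.trans (R.*-cong x≈0 R.refl) (R.zeroˡ y)

  Σᶠ-linear-root : ∀ r {w} → ¬ w ≈ 0# → Σᶠ (λ c → iv F ((r ⊕ w ⊛ c) ≟ 0#)) ≡ 1
  Σᶠ-linear-root r {w} w≉0 =
    Σᶠ-unique (λ c → (r ⊕ w ⊛ c) ≟ 0#) resp root-is-root (λ c → root-unique c)
    where
      open SetoidReasoning R.setoid
      w⁻¹ : Carrier
      w⁻¹ = proj₁ (inverse w w≉0)
      ww⁻¹≈1 : w ⊛ w⁻¹ ≈ 1#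
      ww⁻¹≈1 = proj₂ (inverse w w≉0)
      root : Carrier
      root = w⁻¹ ⊛ ⊝ r

      resp : ∀ {x y} → x ≈ y → r ⊕ w ⊛ x ≈ 0# → r ⊕ w ⊛ y ≈ 0#
      resp x≈y = R.trans (R.+-cong R.refl (R.*-cong R.refl (R.sym x≈y)))

      root-is-root : r ⊕ w ⊛ root ≈ 0#
      root-is-root = begin
        r ⊕ w ⊛ (w⁻¹ ⊛ ⊝ r)  ≈⟨ R.+-cong R.refl (R.sym (R.*-assoc w w⁻¹ (⊝ r))) ⟩
        r ⊕ (w ⊛ w⁻¹) ⊛ ⊝ r  ≈⟨ R.+-cong R.refl (R.*-cong ww⁻¹≈1 R.refl) ⟩
        r ⊕ 1# ⊛ ⊝ r         ≈⟨ R.+-cong R.refl (R.*-identityˡ _) ⟩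
        r ⊕ ⊝ r              ≈⟨ R.-‿inverseʳ r ⟩
        0#                   ∎

      root-unique : ∀ c → r ⊕ w ⊛ c ≈ 0# → c ≈ root
      root-unique c r+wc≈0 = begin
        c                   ≈⟨ R.sym (R.*-identityˡ c) ⟩
        1# ⊛ c              ≈⟨ R.*-cong (R.trans (R.sym ww⁻¹≈1) (R.*-comm w w⁻¹)) R.refl ⟩
        (w⁻¹ ⊛ w) ⊛ c       ≈⟨ R.*-assoc w⁻¹ w c ⟩
        w⁻¹ ⊛ (w ⊛ c)       ≈⟨ R.*-cong R.refl wc≈-r ⟩
        w⁻¹ ⊛ ⊝ r           ∎
        where
          wc≈-r : w ⊛ c ≈ ⊝ r
          wc≈-r = begin
            w ⊛ c                ≈⟨ R.sym (R.+-identityˡ _) ⟩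
            0# ⊕ w ⊛ c           ≈⟨ R.+-cong (R.sym (R.-‿inverseˡ r)) R.refl ⟩
            (⊝ r ⊕ r) ⊕ w ⊛ c    ≈⟨ R.+-assoc _ _ _ ⟩
            ⊝ r ⊕ (r ⊕ w ⊛ c)    ≈⟨ R.+-cong R.refl r+wc≈0 ⟩
            ⊝ r ⊕ 0#             ≈⟨ R.+-identityʳ _ ⟩
            ⊝ r                  ∎

  sumOver-cong : ∀ N {f g : Vec Carrier N → ℕ} → f ≗ g → sumOver F N f ≡ sumOver F N g
  sumOver-cong N f≗g = sum-map-cong f≗g (tuples F N)

  sumOver-*ˡ : ∀ N c (f : Vec Carrier N → ℕ) →
               sumOver F N (λ x → c * f x) ≡ c * sumOver F N f
  sumOver-*ˡ N c f = sum-map-*ˡ c f (tuples F N)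

  sumOver-comm : ∀ M N (f : Vec Carrier M → Vec Carrier N → ℕ) →
    sumOver F M (λ x → sumOver F N (f x)) ≡ sumOver F N (λ y → sumOver F M (λ x → f x y))
  sumOver-comm M N f = sum-map-comm f (tuples F M) (tuples F N)

  sumOver-∷ : ∀ N f → sumOver F (suc N) f ≡ Σᶠ (λ c → sumOver F N (λ x → f (c ∷ x)))
  sumOver-∷ N f = trans (sum-map-concatMap f (λ c → map (c ∷_) (tuples F N)) elems)
    (sum-map-cong (λ c → cong sum (sym (ListP.map-∘ (tuples F N)))) elems)

  sumOver-∷ʳ : ∀ N f → sumOver F (suc N) f ≡ sumOver F N (λ x → Σᶠ (λ c → f (x ∷ʳ c)))
  sumOver-∷ʳ zero    f = trans (sumOver-∷ zero f)
    (trans (sum-map-cong (λ c → ℕP.+-identityʳ (f (c ∷ []))) elems) (sym (ℕP.+-identityʳ _)))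
  sumOver-∷ʳ (suc N) f = begin
    sumOver F (suc (suc N)) f
      ≡⟨ sumOver-∷ (suc N) f ⟩
    Σᶠ (λ b → sumOver F (suc N) (λ x → f (b ∷ x)))
      ≡⟨ sum-map-cong (λ b → sumOver-∷ʳ N (λ x → f (b ∷ x))) elems ⟩
    Σᶠ (λ b → sumOver F N (λ x → Σᶠ (λ c → f (b ∷ (x ∷ʳ c)))))
      ≡⟨ sym (sumOver-∷ N (λ x → Σᶠ (λ c → f (x ∷ʳ c)))) ⟩
    sumOver F (suc N) (λ x → Σᶠ (λ c → f (x ∷ʳ c))) ∎
    where open ≡-Reasoning

  sumOver-const : ∀ N c → sumOver F N (λ _ → c) ≡ q ^ N * c
  sumOver-const zero    c = refl
  sumOver-const (suc N) c = begin
    sumOver F (suc N) (λ _ → c)  ≡⟨ sumOver-∷ N (λ _ → c) ⟩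
    Σᶠ (λ _ → sumOver F N (λ _ → c))  ≡⟨ sum-map-const _ elems ⟩
    q * sumOver F N (λ _ → c)    ≡⟨ cong (q *_) (sumOver-const N c) ⟩
    q * (q ^ N * c)              ≡⟨ sym (ℕP.*-assoc q (q ^ N) c) ⟩
    q * q ^ N * c                ∎
    where open ≡-Reasoning

  sumOver-[]≔ : ∀ N (p : Fin N) (g : Vec Carrier N → ℕ) →
                sumOver F N (λ x → Σᶠ (λ c → g (x [ p ]≔ c))) ≡ q * sumOver F N g
  sumOver-[]≔ (suc N) Fin.zero g = begin
    sumOver F (suc N) (λ x → Σᶠ (λ c → g (x [ Fin.zero ]≔ c)))
      ≡⟨ sumOver-∷ N _ ⟩
    Σᶠ (λ _ → sumOver F N (λ x → Σᶠ (λ c → g (c ∷ x))))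
      ≡⟨ sum-map-cong (λ _ → sum-map-comm (λ x c → g (c ∷ x)) (tuples F N) elems) elems ⟩
    Σᶠ (λ _ → Σᶠ (λ c → sumOver F N (λ x → g (c ∷ x))))
      ≡⟨ sum-map-const _ elems ⟩
    q * Σᶠ (λ c → sumOver F N (λ x → g (c ∷ x)))
      ≡⟨ cong (q *_) (sym (sumOver-∷ N g)) ⟩
    q * sumOver F (suc N) g ∎
    where open ≡-Reasoning
  sumOver-[]≔ (suc N) (Fin.suc p) g = begin
    sumOver F (suc N) (λ x → Σᶠ (λ c → g (x [ Fin.suc p ]≔ c)))
      ≡⟨ sumOver-∷ N _ ⟩
    Σᶠ (λ b → sumOver F N (λ x → Σᶠ (λ c → g (b ∷ (x [ p ]≔ c)))))
      ≡⟨ sum-map-cong (λ b → sumOver-[]≔ N p (λ x → g (b ∷ x))) elems ⟩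
    Σᶠ (λ b → q * sumOver F N (λ x → g (b ∷ x)))
      ≡⟨ sum-map-*ˡ q _ elems ⟩
    q * Σᶠ (λ b → sumOver F N (λ x → g (b ∷ x)))
      ≡⟨ cong (q *_) (sym (sumOver-∷ N g)) ⟩
    q * sumOver F (suc N) g ∎
    where open ≡-Reasoning

  sumOver-prefixIs : ∀ N {k} (a : Vec Carrier k) → k ≤ N →
                     sumOver F N (λ x → iv F (prefixIs? F x a)) ≡ q ^ (N ∸ k)
  sumOver-prefixIs N []  _ = begin
    sumOver F N (λ x → iv F (prefixIs? F x []))  ≡⟨ sumOver-cong N (λ x → iv-yes (prefixIs? F x []) (λ ())) ⟩
    sumOver F N (λ _ → 1)                        ≡⟨ sumOver-const N 1 ⟩
    q ^ N * 1                                    ≡⟨ ℕP.*-identityʳ _ ⟩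
    q ^ N                                        ∎
    where open ≡-Reasoning
  sumOver-prefixIs (suc N) {suc k} (a₀ ∷ a) (s≤s k≤N) = begin
    sumOver F (suc N) (λ x → iv F (prefixIs? F x (a₀ ∷ a)))
      ≡⟨ sumOver-∷ N _ ⟩
    Σᶠ (λ b → sumOver F N (λ x → iv F (prefixIs? F (b ∷ x) (a₀ ∷ a))))
      ≡⟨ sum-map-cong (λ b → sumOver-cong N (prefixIs-∷ b)) elems ⟩
    Σᶠ (λ b → sumOver F N (λ x → iv F (b ≟ a₀) * iv F (prefixIs? F x a)))
      ≡⟨ sum-map-cong (λ b → sumOver-*ˡ N (iv F (b ≟ a₀)) _) elems ⟩
    Σᶠ (λ b → iv F (b ≟ a₀) * sumOver F N (λ x → iv F (prefixIs? F x a)))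
      ≡⟨ sum-map-*ʳ (λ b → iv F (b ≟ a₀)) _ elems ⟩
    Σᶠ (λ b → iv F (b ≟ a₀)) * sumOver F N (λ x → iv F (prefixIs? F x a))
      ≡⟨ cong₂ _*_ (Σᶠ-≈ a₀) (sumOver-prefixIs N a k≤N) ⟩
    1 * q ^ (N ∸ k)
      ≡⟨ ℕP.*-identityˡ _ ⟩
    q ^ (N ∸ k) ∎
    where
      open ≡-Reasoning
      prefixIs-∷ : ∀ b x → iv F (prefixIs? F (b ∷ x) (a₀ ∷ a)) ≡ iv F (b ≟ a₀) * iv F (prefixIs? F x a)
      prefixIs-∷ b x = iv-× (prefixIs? F (b ∷ x) (a₀ ∷ a)) (b ≟ a₀) (prefixIs? F x a)
        (λ pre → pre Fin.zero , pre ∘ Fin.suc)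
        (λ { b≈a₀ pre Fin.zero → b≈a₀ ; b≈a₀ pre (Fin.suc i) → pre i })

  at-[]≔-≢ : ∀ {N} (x : Vec Carrier N) (p : Fin N) c i → i ≢ toℕ p → at F (x [ p ]≔ c) i ≡ at F x i
  at-[]≔-≢ (_ ∷ _)  Fin.zero    c zero    i≢p = ⊥-elim (i≢p refl)
  at-[]≔-≢ (_ ∷ _)  Fin.zero    c (suc i) _   = refl
  at-[]≔-≢ (_ ∷ _)  (Fin.suc p) c zero    _   = refl
  at-[]≔-≢ (_ ∷ xs) (Fin.suc p) c (suc i) i≢p = at-[]≔-≢ xs p c i (i≢p ∘ cong suc)

  at-[]≔-≡ : ∀ {N} (x : Vec Carrier N) (p : Fin N) c → at F (x [ p ]≔ c) (toℕ p) ≡ c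
  at-[]≔-≡ (_ ∷ _)  Fin.zero    c = refl
  at-[]≔-≡ (_ ∷ xs) (Fin.suc p) c = at-[]≔-≡ xs p c

  prefixIs-[]≔ : ∀ {N k} (x : Vec Carrier N) (a : Vec Carrier k) (p : Fin N) c → k ≤ toℕ p →
                 iv F (prefixIs? F (x [ p ]≔ c) a) ≡ iv F (prefixIs? F x a)
  prefixIs-[]≔ x a p c k≤p = iv-cong (prefixIs? F (x [ p ]≔ c) a) (prefixIs? F x a)
    (λ pre i → R.trans (R.reflexive (sym (unchanged i))) (pre i))
    (λ pre i → R.trans (R.reflexive (unchanged i)) (pre i))
    where
      unchanged : ∀ i → at F (x [ p ]≔ c) (toℕ i) ≡ at F x (toℕ i)
      unchanged i = at-[]≔-≢ x p c (toℕ i) (ℕP.<⇒≢ (ℕP.<-≤-trans (FinP.toℕ<n i) k≤p))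

  Σfin-cong : ∀ P {f g : Fin P → Carrier} → (∀ i → f i ≈ g i) → Σfin F P f ≈ Σfin F P g
  Σfin-cong zero    f≈g = R.refl
  Σfin-cong (suc P) f≈g = R.+-cong (f≈g Fin.zero) (Σfin-cong P (f≈g ∘ Fin.suc))

  Σfin-init-last : ∀ P (f : Fin (suc P) → Carrier) →
                   Σfin F (suc P) f ≈ Σfin F P (f ∘ inject₁) ⊕ f (fromℕ P)
  Σfin-init-last zero    f = R.+-comm _ _
  Σfin-init-last (suc P) f =
    R.trans (R.+-cong R.refl (Σfin-init-last P (f ∘ Fin.suc))) (R.sym (R.+-assoc _ _ _))

  Σfin-exchange : ∀ P (d : Fin P) (f g : Fin P → Carrier) → (∀ i → i ≢ d → f i ≈ g i) →
                  Σfin F P f ⊕ g d ≈ Σfin F P g ⊕ f d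
  Σfin-exchange (suc P) Fin.zero f g f≈g = begin
    (f₀ ⊕ Σfin F P (f ∘ Fin.suc)) ⊕ g₀   ≈⟨ R.+-cong (R.+-comm _ _) R.refl ⟩
    (Σfin F P (f ∘ Fin.suc) ⊕ f₀) ⊕ g₀   ≈⟨ R.+-assoc _ _ _ ⟩
    Σfin F P (f ∘ Fin.suc) ⊕ (f₀ ⊕ g₀)   ≈⟨ R.+-cong (Σfin-cong P (λ i → f≈g (Fin.suc i) (λ ())))
                                                      (R.+-comm _ _) ⟩
    Σfin F P (g ∘ Fin.suc) ⊕ (g₀ ⊕ f₀)   ≈⟨ R.sym (R.+-assoc _ _ _) ⟩
    (Σfin F P (g ∘ Fin.suc) ⊕ g₀) ⊕ f₀   ≈⟨ R.+-cong (R.+-comm _ _) R.refl ⟩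
    (g₀ ⊕ Σfin F P (g ∘ Fin.suc)) ⊕ f₀   ∎
    where
      open SetoidReasoning R.setoid
      f₀ g₀ : Carrier
      f₀ = f Fin.zero
      g₀ = g Fin.zero
  Σfin-exchange (suc P) (Fin.suc d) f g f≈g = begin
    (f Fin.zero ⊕ Σfin F P (f ∘ Fin.suc)) ⊕ g (Fin.suc d)
      ≈⟨ R.+-assoc _ _ _ ⟩
    f Fin.zero ⊕ (Σfin F P (f ∘ Fin.suc) ⊕ g (Fin.suc d))
      ≈⟨ R.+-cong (f≈g Fin.zero (λ ()))
                  (Σfin-exchange P d (f ∘ Fin.suc) (g ∘ Fin.suc)
                                 (λ i i≢d → f≈g (Fin.suc i) (i≢d ∘ FinP.suc-injective))) ⟩
    g Fin.zero ⊕ (Σfin F P (g ∘ Fin.suc) ⊕ f (Fin.suc d))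
      ≈⟨ R.sym (R.+-assoc _ _ _) ⟩
    (g Fin.zero ⊕ Σfin F P (g ∘ Fin.suc)) ⊕ f (Fin.suc d) ∎
    where open SetoidReasoning R.setoid

  hankelEntry : ∀ {P N} → Vec Carrier P → Vec Carrier N → ℕ → Carrier
  hankelEntry {P} v x j = Σfin F P (λ i → lookup v i ⊛ at F x (toℕ i + j))

  hankelKills-zero : ∀ {P N} (v : Vec Carrier P) (x : Vec Carrier N) →
                     iv F (hankelKills? F P 0 v x) ≡ 1
  hankelKills-zero {P} v x = iv-yes (hankelKills? F P 0 v x) (λ ())

  hankelKills-suc : ∀ {P N} T (v : Vec Carrier P) (x : Vec Carrier N) →
    iv F (hankelKills? F P (suc T) v x) ≡ iv F (hankelKills? F P T v x) * iv F (hankelEntry v x T ≟ 0#)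
  hankelKills-suc {P} T v x =
    iv-× (hankelKills? F P (suc T) v x) (hankelKills? F P T v x) (hankelEntry v x T ≟ 0#)
      (λ kills → (λ j → entry-cong (FinP.toℕ-inject₁ j) (kills (inject₁ j)))
                , entry-cong (FinP.toℕ-fromℕ T) (kills (fromℕ T)))
      (λ kills last j → kills-suc kills last j (toℕ j ℕP.≟ T))
    where
      entry-cong : ∀ {j j′} → j ≡ j′ → hankelEntry v x j ≈ 0# → hankelEntry v x j′ ≈ 0#
      entry-cong refl = id
      kills-suc : HankelKills F P T v x → hankelEntry v x T ≈ 0# →
                  ∀ j → Dec (toℕ j ≡ T) → hankelEntry v x (toℕ j) ≈ 0#
      kills-suc _     last j (yes j≡T) = entry-cong (sym j≡T) last
      kills-suc kills _    j (no j≢T)  =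
        entry-cong (FinP.toℕ-lower₁ j (j≢T ∘ sym)) (kills (lower₁ j (j≢T ∘ sym)))

  hankelKills-cong : ∀ {P P′ N N′} T (v : Vec Carrier P) (v′ : Vec Carrier P′)
                     (x : Vec Carrier N) (x′ : Vec Carrier N′) →
                     (∀ (j : Fin T) → hankelEntry v x (toℕ j) ≈ hankelEntry v′ x′ (toℕ j)) →
                     iv F (hankelKills? F P T v x) ≡ iv F (hankelKills? F P′ T v′ x′)
  hankelKills-cong {P} {P′} T v v′ x x′ same =
    iv-cong (hankelKills? F P T v x) (hankelKills? F P′ T v′ x′)
      (λ kills j → R.trans (R.sym (same j)) (kills j))
      (λ kills j → R.trans (same j) (kills j))

  lookup-∷ʳ-inject₁ : ∀ {P} (v : Vec Carrier P) c i → lookup (v ∷ʳ c) (inject₁ i) ≡ lookup v i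
  lookup-∷ʳ-inject₁ (_ ∷ _) c Fin.zero    = refl
  lookup-∷ʳ-inject₁ (_ ∷ v) c (Fin.suc i) = lookup-∷ʳ-inject₁ v c i

  lookup-∷ʳ-last : ∀ {P} (v : Vec Carrier P) c → lookup (v ∷ʳ c) (fromℕ P) ≡ c
  lookup-∷ʳ-last []      c = refl
  lookup-∷ʳ-last (_ ∷ v) c = lookup-∷ʳ-last v c

  hankelEntry-∷ʳ-0# : ∀ {P N} (v : Vec Carrier P) {c} → c ≈ 0# → (x : Vec Carrier N) (j : ℕ) →
                      hankelEntry (v ∷ʳ c) x j ≈ hankelEntry v x j
  hankelEntry-∷ʳ-0# {P} v {c} c≈0 x j = begin
    hankelEntry (v ∷ʳ c) x j
      ≈⟨ Σfin-init-last P (λ i → lookup (v ∷ʳ c) i ⊛ at F x (toℕ i + j)) ⟩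
    Σfin F P (λ i → lookup (v ∷ʳ c) (inject₁ i) ⊛ at F x (toℕ (inject₁ i) + j))
      ⊕ lookup (v ∷ʳ c) (fromℕ P) ⊛ at F x (toℕ (fromℕ P) + j)
      ≈⟨ R.+-cong (Σfin-cong P (λ i → R.reflexive (cong₂ (λ vᵢ i′ → vᵢ ⊛ at F x (i′ + j))
                                   (lookup-∷ʳ-inject₁ v c i) (FinP.toℕ-inject₁ i))))
                  (x≈0⇒x*y≈0 _ (R.trans (R.reflexive (lookup-∷ʳ-last v c)) c≈0)) ⟩
    hankelEntry v x j ⊕ 0#
      ≈⟨ R.+-identityʳ _ ⟩
    hankelEntry v x j ∎
    where open SetoidReasoning R.setoid

  hankelKills-∷ʳ-0# : ∀ {P N} T (v : Vec Carrier P) {c} → c ≈ 0# → (x : Vec Carrier N) →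
                      iv F (hankelKills? F (suc P) T (v ∷ʳ c) x) ≡ iv F (hankelKills? F P T v x)
  hankelKills-∷ʳ-0# T v {c} c≈0 x =
    hankelKills-cong T (v ∷ʳ c) v x x (λ j → hankelEntry-∷ʳ-0# v c≈0 x (toℕ j))

  VanishesBeyond : ∀ {P} → Vec Carrier P → Fin P → Set ℓ
  VanishesBeyond v d = ∀ i → toℕ d < toℕ i → lookup v i ≈ 0#

  LastNonzero : ∀ {P} → Vec Carrier P → Fin P → Set ℓ
  LastNonzero v d = ¬ lookup v d ≈ 0# × VanishesBeyond v d

  lastNonzero : ∀ {P} (v : Vec Carrier P) → ¬ IsZero F v → Σ (Fin P) (LastNonzero v)
  lastNonzero []      v≢0 = ⊥-elim (v≢0 (λ ()))
  lastNonzero (b ∷ v) b∷v≢0 with isZero? F v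
  ... | yes v≡0 = Fin.zero , (λ b≈0 → b∷v≢0 (λ { Fin.zero → b≈0 ; (Fin.suc i) → v≡0 i })) , beyond
    where
      beyond : VanishesBeyond (b ∷ v) Fin.zero
      beyond (Fin.suc i) _ = v≡0 i
  ... | no v≢0 with lastNonzero v v≢0
  ... | d , v[d]≉0 , vanishes = Fin.suc d , v[d]≉0 , beyond
    where
      beyond : VanishesBeyond (b ∷ v) (Fin.suc d)
      beyond (Fin.suc i) d<i = vanishes i (ℕP.≤-pred d<i)

  lastNonzero-fromℕ : ∀ {P} (v : Vec Carrier (suc P)) → ¬ lookup v (fromℕ P) ≈ 0# → LastNonzero v (fromℕ P)
  lastNonzero-fromℕ {P} v v[P]≉0 = v[P]≉0 , beyond
    where
      beyond : VanishesBeyond v (fromℕ P)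
      beyond i P<i = ⊥-elim (ℕP.<⇒≱ (subst (_< toℕ i) (FinP.toℕ-fromℕ P) P<i) (ℕP.≤-pred (FinP.toℕ<n i)))

  hankelEntry-[]≔-unchanged : ∀ {P N} (v : Vec Carrier P) (d : Fin P) → VanishesBeyond v d →
    (x : Vec Carrier N) (p : Fin N) (c : Carrier) (j : ℕ) → toℕ d + j < toℕ p →
    hankelEntry v (x [ p ]≔ c) j ≈ hankelEntry v x j
  hankelEntry-[]≔-unchanged {P} v d vanishes x p c j d+j<p = Σfin-cong P term-unchanged
    where
      term-unchanged : ∀ i → lookup v i ⊛ at F (x [ p ]≔ c) (toℕ i + j) ≈ lookup v i ⊛ at F x (toℕ i + j)
      term-unchanged i with toℕ i + j ℕP.≟ toℕ p
      ... | no i+j≢p = R.reflexive (cong (lookup v i ⊛_) (at-[]≔-≢ x p c _ i+j≢p))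
      ... | yes i+j≡p = R.trans (x≈0⇒x*y≈0 _ v[i]≈0) (R.sym (x≈0⇒x*y≈0 _ v[i]≈0))
        where
          v[i]≈0 : lookup v i ≈ 0#
          v[i]≈0 = vanishes i (ℕP.+-cancelʳ-< j (toℕ d) (toℕ i)
                                 (ℕP.<-≤-trans d+j<p (ℕP.≤-reflexive (sym i+j≡p))))

  hankelKills-[]≔ : ∀ {P N} T (v : Vec Carrier P) (d : Fin P) → VanishesBeyond v d →
    (x : Vec Carrier N) (p : Fin N) (c : Carrier) → toℕ d + T ≤ toℕ p →
    iv F (hankelKills? F P T v (x [ p ]≔ c)) ≡ iv F (hankelKills? F P T v x)
  hankelKills-[]≔ T v d vanishes x p c d+T≤p = hankelKills-cong T v v (x [ p ]≔ c) x (λ j →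
    hankelEntry-[]≔-unchanged v d vanishes x p c (toℕ j)
      (ℕP.<-≤-trans (ℕP.+-monoʳ-< (toℕ d) (FinP.toℕ<n j)) d+T≤p))

  hankelEntry-[]≔-linear : ∀ {P N} (v : Vec Carrier P) (d : Fin P) (x : Vec Carrier N) (p : Fin N) (j : ℕ) →
    toℕ p ≡ toℕ d + j → ∀ c →
    hankelEntry v (x [ p ]≔ c) j ≈ hankelEntry v (x [ p ]≔ 0#) j ⊕ lookup v d ⊛ c
  hankelEntry-[]≔-linear {P} v d x p j p≡d+j c = begin
    Σfin F P with-c                  ≈⟨ R.sym (R.+-identityʳ _) ⟩
    Σfin F P with-c ⊕ 0#             ≈⟨ R.+-cong R.refl (R.sym (R.trans (R.reflexive (term-d 0#))
                                                                         (R.zeroʳ _))) ⟩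
    Σfin F P with-c ⊕ with-0# d      ≈⟨ Σfin-exchange P d with-c with-0# off-d ⟩
    Σfin F P with-0# ⊕ with-c d      ≈⟨ R.+-cong R.refl (R.reflexive (term-d c)) ⟩
    Σfin F P with-0# ⊕ lookup v d ⊛ c ∎
    where
      open SetoidReasoning R.setoid
      with-c with-0# : Fin P → Carrier
      with-c  i = lookup v i ⊛ at F (x [ p ]≔ c) (toℕ i + j)
      with-0# i = lookup v i ⊛ at F (x [ p ]≔ 0#) (toℕ i + j)
      term-d : ∀ c′ → lookup v d ⊛ at F (x [ p ]≔ c′) (toℕ d + j) ≡ lookup v d ⊛ c′
      term-d c′ = cong (lookup v d ⊛_) (trans (cong (at F (x [ p ]≔ c′)) (sym p≡d+j)) (at-[]≔-≡ x p c′))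
      off-d : ∀ i → i ≢ d → with-c i ≈ with-0# i
      off-d i i≢d = R.reflexive (cong (lookup v i ⊛_)
        (trans (at-[]≔-≢ x p c _ i+j≢p) (sym (at-[]≔-≢ x p 0# _ i+j≢p))))
        where
          i+j≢p : toℕ i + j ≢ toℕ p
          i+j≢p i+j≡p = i≢d (FinP.toℕ-injective (ℕP.+-cancelʳ-≡ j (toℕ i) (toℕ d) (trans i+j≡p p≡d+j)))

  killSummand : ∀ {N k} (a : Vec Carrier k) {P} T (v : Vec Carrier P) → Vec Carrier N → ℕ
  killSummand a {P} T v x = iv F (prefixIs? F x a) * iv F (hankelKills? F P T v x)

  killCount : ∀ N {k} (a : Vec Carrier k) {P} T (v : Vec Carrier P) → ℕ
  killCount N a T v = sumOver F N (killSummand a T v)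

  killSummand-fibre : ∀ {N k P} (a : Vec Carrier k) T (v : Vec Carrier P) (d : Fin P) → LastNonzero v d →
                      (p : Fin N) → toℕ p ≡ toℕ d + T → k ≤ toℕ p → ∀ x →
                      Σᶠ (λ c → killSummand a (suc T) v (x [ p ]≔ c)) ≡ killSummand a T v x
  killSummand-fibre {P = P} a T v d (v[d]≉0 , vanishes) p p≡d+T k≤p x = begin
    Σᶠ (λ c → killSummand a (suc T) v (x [ p ]≔ c))  ≡⟨ sum-map-cong summand-[]≔ elems ⟩
    Σᶠ (λ c → killSummand a T v x * root? c)          ≡⟨ sum-map-*ˡ (killSummand a T v x) root? elems ⟩
    killSummand a T v x * Σᶠ root?
      ≡⟨ cong (killSummand a T v x *_) (Σᶠ-linear-root r v[d]≉0) ⟩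
    killSummand a T v x * 1                           ≡⟨ ℕP.*-identityʳ _ ⟩
    killSummand a T v x                               ∎
    where
      open ≡-Reasoning
      r : Carrier
      r = hankelEntry v (x [ p ]≔ 0#) T
      root? : Carrier → ℕ
      root? c = iv F ((r ⊕ lookup v d ⊛ c) ≟ 0#)
      pre : Vec Carrier _ → ℕ
      pre y = iv F (prefixIs? F y a)

      summand-[]≔ : ∀ c → killSummand a (suc T) v (x [ p ]≔ c) ≡ killSummand a T v x * root? c
      summand-[]≔ c = begin
        pre (x [ p ]≔ c) * iv F (hankelKills? F P (suc T) v (x [ p ]≔ c))
          ≡⟨ cong₂ _*_ (prefixIs-[]≔ x a p c k≤p) (hankelKills-suc T v (x [ p ]≔ c)) ⟩
        pre x * (iv F (hankelKills? F P T v (x [ p ]≔ c)) * iv F (hankelEntry v (x [ p ]≔ c) T ≟ 0#))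
          ≡⟨ cong (pre x *_) (cong₂ _*_
               (hankelKills-[]≔ T v d vanishes x p c (ℕP.≤-reflexive (sym p≡d+T)))
               (iv-cong (hankelEntry v (x [ p ]≔ c) T ≟ 0#) ((r ⊕ lookup v d ⊛ c) ≟ 0#)
                        (R.trans (R.sym linear)) (R.trans linear))) ⟩
        pre x * (iv F (hankelKills? F P T v x) * root? c)
          ≡⟨ sym (ℕP.*-assoc (pre x) _ _) ⟩
        killSummand a T v x * root? c ∎
        where
          linear : hankelEntry v (x [ p ]≔ c) T ≈ r ⊕ lookup v d ⊛ c
          linear = hankelEntry-[]≔-linear v d x p T p≡d+T c

  killCount-suc : ∀ {N k P} (a : Vec Carrier k) T (v : Vec Carrier P) (d : Fin P) → LastNonzero v d →
                  (p : Fin N) → toℕ p ≡ toℕ d + T → k ≤ toℕ p →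
                  killCount N a T v ≡ q * killCount N a (suc T) v
  killCount-suc {N} a T v d lastNonzero p p≡d+T k≤p = begin
    sumOver F N (killSummand a T v)
      ≡⟨ sumOver-cong N (sym ∘ killSummand-fibre a T v d lastNonzero p p≡d+T k≤p) ⟩
    sumOver F N (λ x → Σᶠ (λ c → killSummand a (suc T) v (x [ p ]≔ c)))
      ≡⟨ sumOver-[]≔ N p (killSummand a (suc T) v) ⟩
    q * sumOver F N (killSummand a (suc T) v) ∎
    where open ≡-Reasoning

  killCount-*-q^ : ∀ {N k P} (a : Vec Carrier k) (v : Vec Carrier P) (d : Fin P) → LastNonzero v d →
                   k ≤ toℕ d → ∀ T → toℕ d + T ≤ N → killCount N a T v * q ^ T ≡ q ^ (N ∸ k)
  killCount-*-q^ {N} {k} a v d _ k≤d zero d+0≤N = begin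
    killCount N a 0 v * 1                       ≡⟨ ℕP.*-identityʳ _ ⟩
    killCount N a 0 v                           ≡⟨ sumOver-cong N no-columns ⟩
    sumOver F N (λ x → iv F (prefixIs? F x a))  ≡⟨ sumOver-prefixIs N a k≤N ⟩
    q ^ (N ∸ k)                                 ∎
    where
      open ≡-Reasoning
      no-columns : ∀ x → killSummand a 0 v x ≡ iv F (prefixIs? F x a)
      no-columns x = trans (cong (iv F (prefixIs? F x a) *_) (hankelKills-zero v x)) (ℕP.*-identityʳ _)
      k≤N : k ≤ N
      k≤N = ℕP.≤-trans k≤d (ℕP.≤-trans (ℕP.m≤m+n _ 0) d+0≤N)
  killCount-*-q^ {N} {k} a v d lastNonzero k≤d (suc T) d+1+T≤N = begin
    killCount N a (suc T) v * (q * q ^ T)   ≡⟨ sym (ℕP.*-assoc (killCount N a (suc T) v) q (q ^ T)) ⟩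
    killCount N a (suc T) v * q * q ^ T     ≡⟨ cong (_* q ^ T) (ℕP.*-comm (killCount N a (suc T) v) q) ⟩
    q * killCount N a (suc T) v * q ^ T
      ≡⟨ cong (_* q ^ T) (sym (killCount-suc a T v d lastNonzero p p≡d+T k≤p)) ⟩
    killCount N a T v * q ^ T               ≡⟨ killCount-*-q^ a v d lastNonzero k≤d T (ℕP.<⇒≤ d+T<N) ⟩
    q ^ (N ∸ k)                             ∎
    where
      open ≡-Reasoning
      d+T<N : toℕ d + T < N
      d+T<N = ℕP.≤-trans (ℕP.≤-reflexive (sym (ℕP.+-suc (toℕ d) T))) d+1+T≤N
      p : Fin N
      p = fromℕ< d+T<N
      p≡d+T : toℕ p ≡ toℕ d + T
      p≡d+T = FinP.toℕ-fromℕ< d+T<N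
      k≤p : k ≤ toℕ p
      k≤p = ℕP.≤-trans k≤d (ℕP.≤-trans (ℕP.m≤m+n _ T) (ℕP.≤-reflexive (sym p≡d+T)))

  nonzero : ∀ {P} → Vec Carrier P → ℕ
  nonzero v = iv F (¬? (isZero? F v))

  nonzero-∷ʳ-0# : ∀ {P} (u : Vec Carrier P) {c} → c ≈ 0# → nonzero (u ∷ʳ c) ≡ nonzero u
  nonzero-∷ʳ-0# u {c} c≈0 = iv-cong (¬? (isZero? F (u ∷ʳ c))) (¬? (isZero? F u))
    (λ u∷ʳc≢0 → u∷ʳc≢0 ∘ isZero-∷ʳ u)
    (λ u≢0 u∷ʳc≡0 → u≢0 (λ i → R.trans (R.reflexive (sym (lookup-∷ʳ-inject₁ u c i))) (u∷ʳc≡0 (inject₁ i))))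
    where
      isZero-∷ʳ : ∀ {P} (u : Vec Carrier P) → IsZero F u → IsZero F (u ∷ʳ c)
      isZero-∷ʳ []      _   Fin.zero    = c≈0
      isZero-∷ʳ (_ ∷ _) u≡0 Fin.zero    = u≡0 Fin.zero
      isZero-∷ʳ (_ ∷ u) u≡0 (Fin.suc i) = isZero-∷ʳ u (u≡0 ∘ Fin.suc) i

  nonzero-∷ʳ-≉0# : ∀ {P} (u : Vec Carrier P) {c} → ¬ c ≈ 0# → nonzero (u ∷ʳ c) ≡ 1
  nonzero-∷ʳ-≉0# {P} u {c} c≉0 = iv-yes (¬? (isZero? F (u ∷ʳ c)))
    (λ u∷ʳc≡0 → c≉0 (R.trans (R.reflexive (sym (lookup-∷ʳ-last u c))) (u∷ʳc≡0 (fromℕ P))))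

  killCount-∷ʳ-0# : ∀ N {k} (a : Vec Carrier k) T {P} (u : Vec Carrier P) {c} → c ≈ 0# →
                    killCount N a T (u ∷ʳ c) ≡ killCount N a T u
  killCount-∷ʳ-0# N a T u c≈0 =
    sumOver-cong N (λ x → cong (iv F (prefixIs? F x a) *_) (hankelKills-∷ʳ-0# T u c≈0 x))

  countS-killCount : ∀ N P T {k} (a : Vec Carrier k) →
                     countS F N P T a ≡ sumOver F P (λ v → nonzero v * killCount N a T v)
  countS-killCount N P T a = begin
    sumOver F N (λ x → pre x * sumOver F P (λ v → nonzero v * kills v x))
      ≡⟨ sumOver-cong N (λ x → sym (sumOver-*ˡ P (pre x) _)) ⟩
    sumOver F N (λ x → sumOver F P (λ v → pre x * (nonzero v * kills v x)))
      ≡⟨ sumOver-comm N P _ ⟩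
    sumOver F P (λ v → sumOver F N (λ x → pre x * (nonzero v * kills v x)))
      ≡⟨ sumOver-cong P (λ v → sumOver-cong N (λ x → x∙yz≈y∙xz (pre x) (nonzero v) (kills v x))) ⟩
    sumOver F P (λ v → sumOver F N (λ x → nonzero v * (pre x * kills v x)))
      ≡⟨ sumOver-cong P (λ v → sumOver-*ˡ N (nonzero v) _) ⟩
    sumOver F P (λ v → nonzero v * killCount N a T v) ∎
    where
      open ≡-Reasoning
      pre : Vec Carrier N → ℕ
      pre x = iv F (prefixIs? F x a)
      kills : Vec Carrier P → Vec Carrier N → ℕ
      kills v x = iv F (hankelKills? F P T v x)

  module _ {k} (m n : ℕ) (a : Vec Carrier k) where

    private
      N : ℕ
      N = m + n + 1

    killCount-top : k ≤ m → (v : Vec Carrier (suc m)) → ¬ lookup v (fromℕ m) ≈ 0# →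
                    killCount N a (n + 1) v ≡ q ^ (m ∸ k)
    killCount-top k≤m v v[m]≉0 =
      ℕP.*-cancelʳ-≡ _ _ (q ^ (n + 1)) {{ℕP.m^n≢0 q (n + 1) {{q-nonZero}}}} (begin
        killCount N a (n + 1) v * q ^ (n + 1)
          ≡⟨ killCount-*-q^ a v (fromℕ m) (lastNonzero-fromℕ v v[m]≉0) (subst (k ≤_) (sym m≡d) k≤m)
                            (n + 1) (ℕP.≤-reflexive (trans (cong (_+ (n + 1)) m≡d)
                                                           (sym (ℕP.+-assoc m n 1)))) ⟩
        q ^ (N ∸ k)
          ≡⟨ cong (q ^_) (trans (cong (_∸ k) (ℕP.+-assoc m n 1)) (ℕP.+-∸-comm (n + 1) k≤m)) ⟩
        q ^ (m ∸ k + (n + 1))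
          ≡⟨ ℕP.^-distribˡ-+-* q (m ∸ k) (n + 1) ⟩
        q ^ (m ∸ k) * q ^ (n + 1) ∎)
      where
        open ≡-Reasoning
        m≡d : toℕ (fromℕ m) ≡ m
        m≡d = FinP.toℕ-fromℕ m

    killCount-lower : k ≤ n + 1 → (u : Vec Carrier m) → ¬ IsZero F u →
                      q * killCount N a (n + 2) u ≡ killCount N a (n + 1) u
    killCount-lower k≤n+1 u u≢0 with lastNonzero u u≢0
    ... | d , last = begin
      q * killCount N a (n + 2) u        ≡⟨ cong (λ T → q * killCount N a T u) (ℕP.+-suc n 1) ⟩
      q * killCount N a (suc (n + 1)) u  ≡⟨ sym (killCount-suc a (n + 1) u d last p p≡d+n+1 k≤p) ⟩
      killCount N a (n + 1) u            ∎
      where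
        open ≡-Reasoning
        d+n+1<N : toℕ d + (n + 1) < N
        d+n+1<N = subst (toℕ d + (n + 1) <_) (sym (ℕP.+-assoc m n 1))
                        (ℕP.+-monoˡ-< (n + 1) (FinP.toℕ<n d))
        p : Fin N
        p = fromℕ< d+n+1<N
        p≡d+n+1 : toℕ p ≡ toℕ d + (n + 1)
        p≡d+n+1 = FinP.toℕ-fromℕ< d+n+1<N
        k≤p : k ≤ toℕ p
        k≤p = subst (k ≤_) (sym p≡d+n+1) (ℕP.≤-trans k≤n+1 (ℕP.m≤n+m (n + 1) (toℕ d)))

    killCount≢0 : Vec Carrier m → ℕ
    killCount≢0 u = nonzero u * killCount N a (n + 1) u

    Σᶠ-∷ʳ-killCount : k ≤ m → ∀ u →
      Σᶠ (λ c → nonzero (u ∷ʳ c) * killCount N a (n + 1) (u ∷ʳ c)) ≡ killCount≢0 u + (q ∸ 1) * q ^ (m ∸ k)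
    Σᶠ-∷ʳ-killCount k≤m u = begin
      Σᶠ (λ c → nonzero (u ∷ʳ c) * killCount N a (n + 1) (u ∷ʳ c))
        ≡⟨ sum-map-cong split elems ⟩
      Σᶠ (λ c → ≈0 c * killCount≢0 u + ≉0 c * q ^ (m ∸ k))
        ≡⟨ sum-map-+ _ _ elems ⟩
      Σᶠ (λ c → ≈0 c * killCount≢0 u) + Σᶠ (λ c → ≉0 c * q ^ (m ∸ k))
        ≡⟨ cong₂ _+_ (sum-map-*ʳ ≈0 _ elems) (sum-map-*ʳ ≉0 _ elems) ⟩
      Σᶠ ≈0 * killCount≢0 u + Σᶠ ≉0 * q ^ (m ∸ k)
        ≡⟨ cong₂ (λ s t → s * killCount≢0 u + t * q ^ (m ∸ k)) (Σᶠ-≈ 0#) Σᶠ-≉0 ⟩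
      1 * killCount≢0 u + (q ∸ 1) * q ^ (m ∸ k)
        ≡⟨ cong (_+ (q ∸ 1) * q ^ (m ∸ k)) (ℕP.*-identityˡ _) ⟩
      killCount≢0 u + (q ∸ 1) * q ^ (m ∸ k) ∎
      where
        open ≡-Reasoning
        ≈0 ≉0 : Carrier → ℕ
        ≈0 c = iv F (c ≟ 0#)
        ≉0 c = iv F (¬? (c ≟ 0#))
        split : ∀ c → nonzero (u ∷ʳ c) * killCount N a (n + 1) (u ∷ʳ c)
                      ≡ ≈0 c * killCount≢0 u + ≉0 c * q ^ (m ∸ k)
        split c with c ≟ 0#
        ... | yes c≈0 = trans (cong₂ _*_ (nonzero-∷ʳ-0# u c≈0) (killCount-∷ʳ-0# N a (n + 1) u c≈0))
                              (sym (trans (ℕP.+-identityʳ _) (ℕP.*-identityˡ _)))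
        ... | no c≉0  = cong₂ _*_ (nonzero-∷ʳ-≉0# u c≉0) (killCount-top k≤m (u ∷ʳ c)
                          (c≉0 ∘ R.trans (R.reflexive (sym (lookup-∷ʳ-last u c)))))

    countS-top : k ≤ m →
      countS F N (m + 1) (n + 1) a ≡ sumOver F m killCount≢0 + q ^ m * ((q ∸ 1) * q ^ (m ∸ k))
    countS-top k≤m = begin
      countS F N (m + 1) (n + 1) a
        ≡⟨ cong (λ P → countS F N P (n + 1) a) (ℕP.+-comm m 1) ⟩
      countS F N (suc m) (n + 1) a
        ≡⟨ countS-killCount N (suc m) (n + 1) a ⟩
      sumOver F (suc m) (λ v → nonzero v * killCount N a (n + 1) v)
        ≡⟨ sumOver-∷ʳ m _ ⟩
      sumOver F m (λ u → Σᶠ (λ c → nonzero (u ∷ʳ c) * killCount N a (n + 1) (u ∷ʳ c)))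
        ≡⟨ sumOver-cong m (Σᶠ-∷ʳ-killCount k≤m) ⟩
      sumOver F m (λ u → killCount≢0 u + (q ∸ 1) * q ^ (m ∸ k))
        ≡⟨ sum-map-+ killCount≢0 _ (tuples F m) ⟩
      sumOver F m killCount≢0 + sumOver F m (λ _ → (q ∸ 1) * q ^ (m ∸ k))
        ≡⟨ cong (_+_ (sumOver F m killCount≢0)) (sumOver-const m _) ⟩
      sumOver F m killCount≢0 + q ^ m * ((q ∸ 1) * q ^ (m ∸ k)) ∎
      where open ≡-Reasoning

    countS-lower : k ≤ n + 1 → q * countS F N m (n + 2) a ≡ sumOver F m killCount≢0
    countS-lower k≤n+1 = begin
      q * countS F N m (n + 2) a
        ≡⟨ cong (q *_) (countS-killCount N m (n + 2) a) ⟩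
      q * sumOver F m (λ u → nonzero u * killCount N a (n + 2) u)
        ≡⟨ sym (sumOver-*ˡ m q _) ⟩
      sumOver F m (λ u → q * (nonzero u * killCount N a (n + 2) u))
        ≡⟨ sumOver-cong m lower ⟩
      sumOver F m killCount≢0 ∎
      where
        open ≡-Reasoning
        lower : ∀ u → q * (nonzero u * killCount N a (n + 2) u) ≡ killCount≢0 u
        lower u with isZero? F u
        ... | yes _  = ℕP.*-zeroʳ q
        ... | no u≢0 = trans (cong (q *_) (ℕP.*-identityˡ _))
                             (trans (killCount-lower k≤n+1 u u≢0) (sym (ℕP.*-identityˡ _)))

lemma3p6 : ∀ {c ℓ : Level} (F : FiniteField c ℓ) (k m n : ℕ) →
    k ≤ m → k ≤ n + 1 → (a : Vec (FiniteField.Carrier F) k) →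
    (+ countS F (m + n + 1) (m + 1) (n + 1) a)
      - (+ card F) Data.Integer.* (+ countS F (m + n + 1) m (n + 2) a)
      ≡ + ((card F ∸ 1) * card F ^ (2 * m ∸ k))
lemma3p6 F k m n k≤m k≤n+1 a = begin
  + countS F N (m + 1) (n + 1) a - + q F Data.Integer.* + countS F N m (n + 2) a
    ≡⟨ cong (+ countS F N (m + 1) (n + 1) a -_) (sym (ℤP.pos-* (q F) _)) ⟩
  + countS F N (m + 1) (n + 1) a - + (q F * countS F N m (n + 2) a)
    ≡⟨ cong₂ (λ s t → + s - + t) (countS-top F m n a k≤m) (countS-lower F m n a k≤n+1) ⟩
  + (S + q F ^ m * ((q F ∸ 1) * q F ^ (m ∸ k))) - + S
    ≡⟨ [+m+n]-[+m]≡+n S _ ⟩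
  + (q F ^ m * ((q F ∸ 1) * q F ^ (m ∸ k)))
    ≡⟨ cong +_ (x^m*[y*x^[m∸k]]≡y*x^[2m∸k] (q F) (q F ∸ 1) m k k≤m) ⟩
  + ((q F ∸ 1) * q F ^ (2 * m ∸ k)) ∎
  where
    open ≡-Reasoning
    N S : ℕ
    N = m + n + 1
    S = sumOver F m (killCount≢0 F m n a)
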